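{- Let $\mathcal{R}$ and $\mathcal{S}$ be TRSs such that (1) ${\to_{\mathcal{R}}}\subseteq{\to_{\mathcal{S}}}\subseteq{\stackrel{*}{\leftrightarrow}_{\mathcal{R}}}$ and (2) $\mathrm{NF}(\mathcal{R})\subseteq\mathrm{NF}(\mathcal{S})$. Then: (i) if $\mathcal{S}$ is confluent then $\mathcal{R}$ has UNC; (ii) if there exist distinct $s,t\in\mathrm{NF}(\mathcal{S})$ with $s\stackrel{*}{\leftrightarrow}_{\mathcal{S}}t$, then $\mathcal{R}$ does not have UNC.
   Context: A TRS is a finite set of rewrite rules $l\to r$ ($l$ not a variable, $\mathcal{V}(r)\subseteq\mathcal{V}(l)$) over terms with variables; $\to_{\mathcal{R}}$ is the rewrite relation, $\stackrel{*}{\leftrightarrow}_{\mathcal{R}}$ its equivalence closure, $\mathrm{NF}(\mathcal{R})$ the set of normal forms. $\mathcal{R}$ has UNC if $s\stackrel{*}{\leftrightarrow}_{\mathcal{R}}t$ and $s,t\in\mathrm{NF}(\mathcal{R})$ imply $s=t$; $\mathcal{S}$ is confluent if ${\stackrel{*}{\leftarrow}_{\mathcal{S}}\circ\stackrel{*}{\to}_{\mathcal{S}}}\subseteq{\stackrel{*}{\to}_{\mathcal{S}}\circ\stackrel{*}{\leftarrow}_{\mathcal{S}}}$. -}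

module Defs where

open import Data.Nat using (ℕ)
open import Data.Fin using (Fin)
open import Data.Vec using (Vec; []; _∷_; lookup; _[_]≔_)
open import Data.List using (List)
open import Data.List.Membership.Propositional using (_∈_)
open import Data.Product using (Σ; ∃; _×_; _,_)
open import Relation.Nullary using (¬_)
open import Relation.Binary.PropositionalEquality using (_≡_)
open import Relation.Binary.Construct.Closure.ReflexiveTransitive using (Star)
open import Relation.Binary.Construct.Closure.Equivalence using (EqClosure)

record Signature : Set₁ where
  field
    Sym   : Set
    arity : Sym → ℕ
open Signature public

Var : Set
Var = ℕ

module _ (Σ' : Signature) where

  data Term : Set where
    var : Var → Term
    fun : (f : Sym Σ') → Vec Term (arity Σ' f) → Term

  Subst : Set
  Subst = Var → Term

  mutual
    _⟨_⟩ : Term → Subst → Term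
    var x    ⟨ σ ⟩ = σ x
    fun f ts ⟨ σ ⟩ = fun f (substs ts σ)

    substs : ∀ {n} → Vec Term n → Subst → Vec Term n
    substs []       σ = []
    substs (t ∷ ts) σ = (t ⟨ σ ⟩) ∷ substs ts σ

  data _∈𝒱_ (x : Var) : Term → Set where
    here : x ∈𝒱 var x
    arg  : ∀ {f ts} (i : Fin (arity Σ' f)) → x ∈𝒱 lookup ts i → x ∈𝒱 fun f ts

  record Rule : Set where
    field
      lhs      : Term
      rhs      : Term
      lhs-nvar : ¬ (∃ λ x → lhs ≡ var x)
      vars-ok  : ∀ x → x ∈𝒱 rhs → x ∈𝒱 lhs
  open Rule public

  TRS : Set
  TRS = List Rule

  data Step (R : TRS) : Term → Term → Set where
    root : ∀ {ρ} (σ : Subst) → ρ ∈ R → Step R (lhs ρ ⟨ σ ⟩) (rhs ρ ⟨ σ ⟩)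
    cong : ∀ {f ts u} (i : Fin (arity Σ' f)) → Step R (lookup ts i) u →
           Step R (fun f ts) (fun f (ts [ i ]≔ u))

  Steps : TRS → Term → Term → Set
  Steps R = Star (Step R)

  Conv : TRS → Term → Term → Set
  Conv R = EqClosure (Step R)

  NF : TRS → Term → Set
  NF R s = ∀ t → ¬ Step R s t

  UNC : TRS → Set
  UNC R = ∀ s t → Conv R s t → NF R s → NF R t → s ≡ t

  Confluent : TRS → Set
  Confluent S = ∀ s t u → Steps S s t → Steps S s u →
                ∃ λ v → Steps S t v × Steps S u v

-- By (1), R- and S-conversion coincide, and by (2) together with R ⊆ S the
-- two systems have the same normal forms. (i) Under confluence of S, two
-- R-convertible R-normal forms are S-convertible S-normal forms, hence have a
-- common S-reduct, which must equal both. (ii) The given pair of S-normal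
-- forms is a pair of distinct R-convertible R-normal forms.
module Submission where

open import Defs
open import Data.Product using (∃; _×_; _,_)
open import Data.Empty using (⊥-elim)
open import Relation.Nullary using (¬_)
open import Relation.Binary.PropositionalEquality using (_≡_; _≢_; refl; trans; sym)
open import Relation.Binary.Construct.Closure.ReflexiveTransitive using (ε; _◅_; _◅◅_)
open import Relation.Binary.Construct.Closure.Symmetric using (fwd; bwd)
import Relation.Binary.Construct.Closure.Equivalence as EqClosure

module _ {Σ' : Signature} where

  _⊆Step_ : TRS Σ' → TRS Σ' → Set
  R ⊆Step S = ∀ s t → Step Σ' R s t → Step Σ' S s t

  Conv-mono : ∀ {R S} → R ⊆Step S → ∀ {s t} → Conv Σ' R s t → Conv Σ' S s t
  Conv-mono R⊆S = EqClosure.map (λ {s} {t} → R⊆S s t)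

  Conv-⊆-Conv : ∀ {R S} → (∀ s t → Step Σ' S s t → Conv Σ' R s t) →
                ∀ {s t} → Conv Σ' S s t → Conv Σ' R s t
  Conv-⊆-Conv S⊆R s↔t = EqClosure.join (EqClosure.map (λ {s} {t} → S⊆R s t) s↔t)

  NF-antitone : ∀ {R S} → R ⊆Step S → ∀ t → NF Σ' S t → NF Σ' R t
  NF-antitone R⊆S t nf u t→u = nf u (R⊆S t u t→u)

  NF-Steps-≡ : ∀ {S s v} → NF Σ' S s → Steps Σ' S s v → s ≡ v
  NF-Steps-≡ nf ε       = refl
  NF-Steps-≡ nf (s→ ◅ _) = ⊥-elim (nf _ s→)

  Confluent⇒Church-Rosser : ∀ {S} → Confluent Σ' S → ∀ {s t} → Conv Σ' S s t →
                            ∃ λ v → Steps Σ' S s v × Steps Σ' S t v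
  Confluent⇒Church-Rosser conf {s} ε = s , ε , ε
  Confluent⇒Church-Rosser conf (fwd s→u ◅ u↔t)
    with v , u↠v , t↠v ← Confluent⇒Church-Rosser conf u↔t
    = v , s→u ◅ u↠v , t↠v
  Confluent⇒Church-Rosser conf {s} (bwd u→s ◅ u↔t)
    with v , u↠v , t↠v ← Confluent⇒Church-Rosser conf u↔t
    with w , s↠w , v↠w ← conf _ s v (u→s ◅ ε) u↠v
    = w , s↠w , t↠v ◅◅ v↠w

  Confluent⇒UNC : ∀ {S} → Confluent Σ' S → UNC Σ' S
  Confluent⇒UNC conf s t s↔t nf-s nf-t
    with v , s↠v , t↠v ← Confluent⇒Church-Rosser conf s↔t
    = trans (NF-Steps-≡ nf-s s↠v) (sym (NF-Steps-≡ nf-t t↠v))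

lemma1 : (Σ' : Signature) (R S : TRS Σ') →
         (∀ s t → Step Σ' R s t → Step Σ' S s t) →
         (∀ s t → Step Σ' S s t → Conv Σ' R s t) →
         (∀ t → NF Σ' R t → NF Σ' S t) →
         (Confluent Σ' S → UNC Σ' R) ×
         ((∃ λ s → ∃ λ t → NF Σ' S s × NF Σ' S t × s ≢ t × Conv Σ' S s t) → ¬ UNC Σ' R)
lemma1 Σ' R S R⊆S S⊆R* NF-R⊆NF-S = UNC-R , ¬UNC-R
  where
  UNC-R : Confluent Σ' S → UNC Σ' R
  UNC-R conf s t s↔t nf-s nf-t =
    Confluent⇒UNC conf s t (Conv-mono R⊆S s↔t) (NF-R⊆NF-S s nf-s) (NF-R⊆NF-S t nf-t)

  ¬UNC-R : (∃ λ s → ∃ λ t → NF Σ' S s × NF Σ' S t × s ≢ t × Conv Σ' S s t) → ¬ UNC Σ' R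
  ¬UNC-R (s , t , nf-s , nf-t , s≢t , s↔t) unc =
    s≢t (unc s t (Conv-⊆-Conv S⊆R* s↔t)
                 (NF-antitone R⊆S s nf-s) (NF-antitone R⊆S t nf-t))
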